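{- Let $T$ be a regular tournament and $W\subseteq V(T)$. Then $s(W)\ge \binom{|W|}{2}$.
   Context: A tournament is regular if every vertex has equal in- and out-degree. For distinct vertices $x,y$ of $T$, $p_2(x,y)$ is the number of directed paths of length $2$ from $x$ to $y$, $\pi_2(T)=\min\{p_2(x,y): x\ne y\}$, the surplus of $\{x,y\}$ is $s(x,y)=p_2(x,y)+p_2(y,x)-2\pi_2(T)$, and $s(W)=\sum s(x,y)$ over all unordered pairs of distinct vertices of $W$. -}

module Defs where

open import Data.Bool using (Bool; true; false; not; _∧_; if_then_else_)
open import Data.Nat using (ℕ; zero; suc; _⊓_; _+_)
open import Data.Fin using (Fin)
open import Data.Fin.Properties using (_≟_)
open import Data.Fin.Subset using (Subset; _∈_)
open import Data.Fin.Subset.Properties using (_∈?_)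
open import Data.List using (List; []; _∷_; foldr; map; filter; length; concatMap; sum)
open import Data.List.Base using (allFin)
open import Data.Integer as ℤ using (ℤ; +_)
open import Data.Product using (_×_; _,_)
open import Relation.Nullary using (¬_; Dec; yes; no)
open import Relation.Nullary.Decidable using (⌊_⌋)
open import Relation.Binary.PropositionalEquality using (_≡_; _≢_)

-- A digraph on vertex set Fin n, given by its arc relation: beats x y = true iff x → y.
Digraph : ℕ → Set
Digraph n = Fin n → Fin n → Bool

IsTournament : {n : ℕ} → Digraph n → Set
IsTournament {n} T =
  ((x : Fin n) → T x x ≡ false) ×
  ((x y : Fin n) → x ≢ y → T x y ≡ not (T y x))

count : {n : ℕ} → (Fin n → Bool) → ℕ
count {n} P = length (filter (λ v → P v Data.Bool.≟ true) (allFin n))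

outdeg : {n : ℕ} → Digraph n → Fin n → ℕ
outdeg T x = count (λ y → T x y)

indeg : {n : ℕ} → Digraph n → Fin n → ℕ
indeg T x = count (λ y → T y x)

IsRegular : {n : ℕ} → Digraph n → Set
IsRegular {n} T = (x : Fin n) → outdeg T x ≡ indeg T x

p₂ : {n : ℕ} → Digraph n → Fin n → Fin n → ℕ
p₂ T x y = count (λ z → T x z ∧ T z y)

distinctPairs : (n : ℕ) → List (Fin n × Fin n)
distinctPairs n =
  concatMap (λ x → map (λ y → (x , y)) (filter (λ y → ¬? (x ≟ y)) (allFin n))) (allFin n)
  where
    open import Relation.Nullary.Decidable using (¬?)

-- minimum of a list of naturals (0 for the empty list; only relevant when n ≤ 1)
minList : List ℕ → ℕ
minList [] = 0
minList (a ∷ as) = foldr _⊓_ a as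

π₂ : {n : ℕ} → Digraph n → ℕ
π₂ {n} T = minList (map (λ { (x , y) → p₂ T x y }) (distinctPairs n))

surplus : {n : ℕ} → Digraph n → Fin n → Fin n → ℤ
surplus T x y = (+ (p₂ T x y + p₂ T y x)) ℤ.- (+ 2) ℤ.* (+ π₂ T)

unorderedPairsIn : {n : ℕ} → Subset n → List (Fin n × Fin n)
unorderedPairsIn {n} W =
  concatMap (λ x → map (λ y → (x , y))
                       (filter (λ y → (x Data.Fin.<? y) ×-dec' (y ∈? W)) (allFin n)))
            (filter (λ x → x ∈? W) (allFin n))
  where
    open import Relation.Nullary.Decidable using (_×-dec_)
    _×-dec'_ = _×-dec_

surplusSet : {n : ℕ} → Digraph n → Subset n → ℤ
surplusSet T W = foldr ℤ._+_ (+ 0) (map (λ { (x , y) → surplus T x y }) (unorderedPairsIn W))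

-- In a regular tournament all out-degrees are equal, so comparing the out-neighbourhoods of the two
-- ends of an arc x → y gives p₂(y,x) = p₂(x,y) + 1. Hence p₂(x,y) + p₂(y,x) ≥ 2 p₂(x,y) + 1 ≥ 2 π₂(T) + 1,
-- i.e. every pair of distinct vertices has surplus at least 1, and W has ∣W∣ choose 2 such pairs.
module Submission where

open import Defs
open import Data.Nat using (ℕ)
open import Data.Nat.Combinatorics using (_C_)
open import Data.Fin.Subset using (Subset; ∣_∣)
open import Data.Integer using (+_; _≤_)

open import Data.Nat.Properties
  using ( +-0-commutativeMonoid; +-identityʳ; +-suc; +-comm; +-cancelˡ-≡; +-cancelʳ-≡; +-monoʳ-<
        ; *-identityˡ; *-identityʳ; *-zeroʳ; *-cancelˡ-≡; *-monoʳ-≤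
        ; ≤-refl; ≤-trans; ≤-reflexive; ≤-<-trans; <⇒≤; m⊓n≤m; m⊓n≤n; m<n⇒0<n∸m )
open import Algebra.Properties.CommutativeMonoid.Sum +-0-commutativeMonoid
  using (sum-syntax; ∑-distrib-+; sum-cong-≗)
open import Data.Bool using (Bool; true; false; not; _∧_)
import Data.Bool as Bool
open import Data.Fin using (Fin; zero; suc; _<?_)
open import Data.Fin.Properties using (_≟_; <⇒≢)
open import Data.Fin.Subset.Properties using (_∈?_)
import Data.Integer as ℤ
import Data.Integer.Properties as ℤ
open import Data.List using (List; []; _∷_; foldr; map; filter; length; concatMap; tabulate; allFin)
open import Data.List.Membership.Propositional using (_∈_)
open import Data.List.Membership.Propositional.Properties using (∈-map⁺; ∈-concatMap⁺; ∈-filter⁺; ∈-allFin)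
open import Data.List.Properties using (length-++; length-map; map-cong)
open import Data.List.Relation.Unary.All as All using (All; []; _∷_)
open import Data.List.Relation.Unary.All.Properties using (map⁺; concat⁺; all-filter)
open import Data.List.Relation.Unary.Any as Any using (here; there)
open import Data.Nat as ℕ using (suc; _+_; _*_; _⊓_; _<_)
open import Data.Nat.Combinatorics using (nC1≡n; nCk+nC[k+1]≡[n+1]C[k+1])
open import Data.Nat.ListAction using (sum)
open import Data.Product using (_×_; _,_; proj₁; proj₂)
open import Data.Sum using (_⊎_; inj₁; inj₂)
open import Data.Vec using (_∷_; [])
open import Function using (_∘_; id)
open import Relation.Binary.PropositionalEquality
open import Relation.Nullary using (Dec; yes; no; does; ¬?; _×-dec_)
open import Relation.Unary using (Pred; Decidable)

⟦_⟧ : Bool → ℕ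
⟦ true ⟧ = 1
⟦ false ⟧ = 0

∑-const : ∀ n c → ∑[ i < n ] c ≡ n * c
∑-const ℕ.zero c = refl
∑-const (suc n) c = cong (_+_ c) (∑-const n c)

∑-δ : ∀ {n} (v : Fin n) → ∑[ z < n ] ⟦ does (z ≟ v) ⟧ ≡ 1
∑-δ {suc n} zero = cong suc (trans (∑-const n 0) (*-zeroʳ n))
∑-δ {suc n} (suc v) = ∑-δ v

module _ {a p} {A : Set a} {P : Pred A p} (P? : Decidable P) where

  length-filter-tabulate : ∀ {n} (f : Fin n → A) →
    length (filter P? (tabulate f)) ≡ ∑[ i < n ] ⟦ does (P? (f i)) ⟧
  length-filter-tabulate {ℕ.zero} f = refl
  length-filter-tabulate {suc n} f with does (P? (f zero))
  ... | true = cong suc (length-filter-tabulate (f ∘ suc))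
  ... | false = length-filter-tabulate (f ∘ suc)

  sum-map-filter-tabulate : ∀ {n} (g : A → ℕ) (f : Fin n → A) →
    sum (map g (filter P? (tabulate f))) ≡ ∑[ i < n ] (⟦ does (P? (f i)) ⟧ * g (f i))
  sum-map-filter-tabulate {ℕ.zero} g f = refl
  sum-map-filter-tabulate {suc n} g f with does (P? (f zero))
  ... | true = cong₂ _+_ (sym (+-identityʳ (g (f zero)))) (sum-map-filter-tabulate g (f ∘ suc))
  ... | false = sum-map-filter-tabulate g (f ∘ suc)

length-concatMap : ∀ {a b} {A : Set a} {B : Set b} (f : A → List B) xs →
  length (concatMap f xs) ≡ sum (map (length ∘ f) xs)
length-concatMap f [] = refl
length-concatMap f (x ∷ xs) = trans (length-++ (f x)) (cong (_+_ (length (f x))) (length-concatMap f xs))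

count-∑ : ∀ {n} (P : Fin n → Bool) → count P ≡ ∑[ z < n ] ⟦ P z ⟧
count-∑ P = trans (length-filter-tabulate (λ v → P v Bool.≟ true) id) (sum-cong-≗ (does-≟true ∘ P))
  where
    does-≟true : ∀ b → ⟦ does (b Bool.≟ true) ⟧ ≡ ⟦ b ⟧
    does-≟true true = refl
    does-≟true false = refl

count-const : ∀ n b → count {n} (λ _ → b) ≡ n * ⟦ b ⟧
count-const n b = trans (count-∑ {n} (λ _ → b)) (∑-const n ⟦ b ⟧)

count-≡ : ∀ {n} (v : Fin n) → count (λ z → does (z ≟ v)) ≡ 1
count-≡ v = trans (count-∑ (λ z → does (z ≟ v))) (∑-δ v)

count-balance : ∀ {n} (P Q R S U : Fin n → Bool) →
  (∀ z → ⟦ P z ⟧ + ⟦ Q z ⟧ + ⟦ R z ⟧ ≡ ⟦ S z ⟧ + ⟦ U z ⟧) →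
  count P + count Q + count R ≡ count S + count U
count-balance {n} P Q R S U pointwise = begin
    count P + count Q + count R
  ≡⟨ cong₂ _+_ (cong₂ _+_ (count-∑ P) (count-∑ Q)) (count-∑ R) ⟩
    ∑[ z < n ] ⟦ P z ⟧ + ∑[ z < n ] ⟦ Q z ⟧ + ∑[ z < n ] ⟦ R z ⟧
  ≡⟨ cong (_+ _) (∑-distrib-+ (⟦_⟧ ∘ P) (⟦_⟧ ∘ Q)) ⟨
    ∑[ z < n ] (⟦ P z ⟧ + ⟦ Q z ⟧) + ∑[ z < n ] ⟦ R z ⟧
  ≡⟨ ∑-distrib-+ _ (⟦_⟧ ∘ R) ⟨
    ∑[ z < n ] (⟦ P z ⟧ + ⟦ Q z ⟧ + ⟦ R z ⟧)
  ≡⟨ sum-cong-≗ pointwise ⟩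
    ∑[ z < n ] (⟦ S z ⟧ + ⟦ U z ⟧)
  ≡⟨ ∑-distrib-+ (⟦_⟧ ∘ S) (⟦_⟧ ∘ U) ⟩
    ∑[ z < n ] ⟦ S z ⟧ + ∑[ z < n ] ⟦ U z ⟧
  ≡⟨ cong₂ _+_ (count-∑ S) (count-∑ U) ⟨
    count S + count U ∎
  where open ≡-Reasoning

foldr-⊓-≤ : ∀ a as {m} → m ∈ a ∷ as → foldr _⊓_ a as ℕ.≤ m
foldr-⊓-≤ a [] (here refl) = ≤-refl
foldr-⊓-≤ a (b ∷ bs) (here refl) = ≤-trans (m⊓n≤n b _) (foldr-⊓-≤ a bs (here refl))
foldr-⊓-≤ a (b ∷ bs) (there (here refl)) = m⊓n≤m b _
foldr-⊓-≤ a (b ∷ bs) (there (there m∈bs)) = ≤-trans (m⊓n≤n b _) (foldr-⊓-≤ a bs (there m∈bs))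

minList-≤ : ∀ {m} xs → m ∈ xs → minList xs ℕ.≤ m
minList-≤ (a ∷ as) = foldr-⊓-≤ a as

∈-distinctPairs : ∀ {n} {x y : Fin n} → x ≢ y → (x , y) ∈ distinctPairs n
∈-distinctPairs {n} {x} {y} x≢y = ∈-concatMap⁺ _ (Any.map
  (λ { refl → ∈-map⁺ (x ,_) (∈-filter⁺ (λ y → ¬? (x ≟ y)) (∈-allFin y) x≢y) })
  (∈-allFin x))

π₂≤p₂ : ∀ {n} (T : Digraph n) {x y} → x ≢ y → π₂ T ℕ.≤ p₂ T x y
π₂≤p₂ T x≢y = minList-≤ _ (∈-map⁺ (λ { (x , y) → p₂ T x y }) (∈-distinctPairs x≢y))

surplus-positive : ∀ {n} (T : Digraph n) {x y} →
  2 * π₂ T < p₂ T x y + p₂ T y x → + 1 ≤ surplus T x y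
surplus-positive T {x} {y} 2π₂<p₂+p₂
  rewrite sym (ℤ.pos-* 2 (π₂ T)) | ℤ.m-n≡m⊖n (p₂ T x y + p₂ T y x) (2 * π₂ T)
        | ℤ.⊖-≥ (<⇒≤ 2π₂<p₂+p₂) = ℤ.+≤+ (m<n⇒0<n∸m 2π₂<p₂+p₂)

2m<n+1+n : ∀ {m n} → m ℕ.≤ n → 2 * m < n + suc n
2m<n+1+n {m} {n} m≤n = ≤-<-trans (*-monoʳ-≤ 2 m≤n)
  (+-monoʳ-< n (ℕ.s≤s (≤-reflexive (+-identityʳ n))))

module _ {n} {T : Digraph n} (tournament : IsTournament T) where

  private
    loopless : ∀ x → T x x ≡ false
    loopless = proj₁ tournament

    antisymmetric : ∀ x y → x ≢ y → T x y ≡ not (T y x)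
    antisymmetric = proj₂ tournament

  arc⇒≢ : ∀ {x y} → T x y ≡ true → x ≢ y
  arc⇒≢ {x} x→y refl with () ← trans (sym (loopless x)) x→y

  arc-between : ∀ {x y} → x ≢ y → T x y ≡ true ⊎ T y x ≡ true
  arc-between {x} {y} x≢y with T y x in y→x
  ... | true = inj₂ refl
  ... | false = inj₁ (trans (antisymmetric x y x≢y) (cong not y→x))

  outdeg+indeg+1≡n : ∀ v → outdeg T v + indeg T v + 1 ≡ n
  outdeg+indeg+1≡n v = begin
      outdeg T v + indeg T v + 1
    ≡⟨ cong (_+_ (outdeg T v + indeg T v)) (count-≡ v) ⟨
      outdeg T v + indeg T v + count (λ z → does (z ≟ v))
    ≡⟨ count-balance (T v) (λ z → T z v) (λ z → does (z ≟ v)) (λ _ → true) (λ _ → false) pointwise ⟩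
      count {n} (λ _ → true) + count {n} (λ _ → false)
    ≡⟨ cong₂ _+_ (trans (count-const n true) (*-identityʳ n)) (trans (count-const n false) (*-zeroʳ n)) ⟩
      n + 0
    ≡⟨ +-identityʳ n ⟩
      n ∎
    where
      open ≡-Reasoning
      pointwise : ∀ z → ⟦ T v z ⟧ + ⟦ T z v ⟧ + ⟦ does (z ≟ v) ⟧ ≡ 1
      pointwise z with z ≟ v
      ... | yes refl rewrite loopless z = refl
      ... | no z≢v rewrite antisymmetric z v z≢v with T v z
      ...   | true = refl
      ...   | false = refl

  -- Sort the out-neighbours of x and of y by their relation to the other vertex; the common out-neighbours cancel.
  arc-balance : ∀ {x y} → T x y ≡ true →
    outdeg T y + p₂ T x y + 1 ≡ outdeg T x + p₂ T y x
  arc-balance {x} {y} x→y = begin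
      outdeg T y + p₂ T x y + 1
    ≡⟨ cong (_+_ (outdeg T y + p₂ T x y)) (count-≡ y) ⟨
      outdeg T y + p₂ T x y + count (λ z → does (z ≟ y))
    ≡⟨ count-balance (T y) (λ z → T x z ∧ T z y) (λ z → does (z ≟ y)) (T x) (λ z → T y z ∧ T z x) pointwise ⟩
      outdeg T x + p₂ T y x ∎
    where
      open ≡-Reasoning
      pointwise : ∀ z → ⟦ T y z ⟧ + ⟦ T x z ∧ T z y ⟧ + ⟦ does (z ≟ y) ⟧ ≡ ⟦ T x z ⟧ + ⟦ T y z ∧ T z x ⟧
      pointwise z with z ≟ y
      ... | yes refl rewrite loopless z | x→y = refl
      ... | no z≢y with z ≟ x
      ...   | yes refl rewrite loopless z | antisymmetric y z (z≢y ∘ sym) | x→y = refl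
      ...   | no z≢x rewrite antisymmetric z x z≢x | antisymmetric z y z≢y with T x z | T y z
      ...     | true  | true  = refl
      ...     | true  | false = refl
      ...     | false | true  = refl
      ...     | false | false = refl

module _ {n} {T : Digraph n} (tournament : IsTournament T) (regular : IsRegular T) where

  regular⇒2*outdeg+1≡n : ∀ v → 2 * outdeg T v + 1 ≡ n
  regular⇒2*outdeg+1≡n v = trans
    (cong (λ d → outdeg T v + d + 1) (trans (+-identityʳ (outdeg T v)) (regular v)))
    (outdeg+indeg+1≡n tournament v)

  regular⇒outdeg-constant : ∀ x y → outdeg T x ≡ outdeg T y
  regular⇒outdeg-constant x y = *-cancelˡ-≡ _ _ 2 (+-cancelʳ-≡ 1 _ _
    (trans (regular⇒2*outdeg+1≡n x) (sym (regular⇒2*outdeg+1≡n y))))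

  regular⇒p₂-reverse : ∀ {x y} → T x y ≡ true → p₂ T y x ≡ suc (p₂ T x y)
  regular⇒p₂-reverse {x} {y} x→y = sym (+-cancelˡ-≡ (outdeg T x) _ _ (begin
      outdeg T x + suc (p₂ T x y)
    ≡⟨ cong (_+ suc (p₂ T x y)) (regular⇒outdeg-constant x y) ⟩
      outdeg T y + suc (p₂ T x y)
    ≡⟨ +-suc (outdeg T y) (p₂ T x y) ⟩
      suc (outdeg T y + p₂ T x y)
    ≡⟨ +-comm 1 _ ⟩
      outdeg T y + p₂ T x y + 1
    ≡⟨ arc-balance tournament x→y ⟩
      outdeg T x + p₂ T y x ∎))
    where open ≡-Reasoning

  arc⇒2*π₂<p₂+p₂ : ∀ {x y} → T x y ≡ true → 2 * π₂ T < p₂ T x y + p₂ T y x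
  arc⇒2*π₂<p₂+p₂ {x} {y} x→y rewrite regular⇒p₂-reverse x→y =
    2m<n+1+n (π₂≤p₂ T (arc⇒≢ tournament x→y))

  regular⇒2*π₂<p₂+p₂ : ∀ {x y} → x ≢ y → 2 * π₂ T < p₂ T x y + p₂ T y x
  regular⇒2*π₂<p₂+p₂ {x} {y} x≢y with arc-between tournament x≢y
  ... | inj₁ x→y = arc⇒2*π₂<p₂+p₂ x→y
  ... | inj₂ y→x = subst (2 * π₂ T <_) (+-comm (p₂ T y x) (p₂ T x y)) (arc⇒2*π₂<p₂+p₂ y→x)

unorderedPairsIn-distinct : ∀ {n} (W : Subset n) → All (λ p → proj₁ p ≢ proj₂ p) (unorderedPairsIn W)
unorderedPairsIn-distinct {n} W = concat⁺ (map⁺ (All.universal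
  (λ x → map⁺ (All.map (<⇒≢ ∘ proj₁) (all-filter (λ y → (x <? y) ×-dec (y ∈? W)) (allFin n))))
  (filter (_∈? W) (allFin n))))

ascendingPairs : ∀ {n} → Subset n → ℕ
ascendingPairs {n} W = ∑[ x < n ] (⟦ does (x ∈? W) ⟧ * ∑[ y < n ] ⟦ does ((x <? y) ×-dec (y ∈? W)) ⟧)

length-unorderedPairsIn : ∀ {n} (W : Subset n) → length (unorderedPairsIn W) ≡ ascendingPairs W
length-unorderedPairsIn {n} W = begin
    length (unorderedPairsIn W)
  ≡⟨ length-concatMap (λ x → map (x ,_) (filter (Q x) (allFin n))) (filter (_∈? W) (allFin n)) ⟩
    sum (map (λ x → length (map (x ,_) (filter (Q x) (allFin n)))) (filter (_∈? W) (allFin n)))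
  ≡⟨ cong sum (map-cong (λ x → length-map (x ,_) (filter (Q x) (allFin n))) (filter (_∈? W) (allFin n))) ⟩
    sum (map (λ x → length (filter (Q x) (allFin n))) (filter (_∈? W) (allFin n)))
  ≡⟨ sum-map-filter-tabulate (_∈? W) _ id ⟩
    ∑[ x < n ] (⟦ does (x ∈? W) ⟧ * length (filter (Q x) (allFin n)))
  ≡⟨ sum-cong-≗ (λ x → cong (⟦ does (x ∈? W) ⟧ *_) (length-filter-tabulate (Q x) id)) ⟩
    ascendingPairs W ∎
  where
    open ≡-Reasoning
    Q : ∀ x y → Dec ((x Data.Fin.< y) × (y Data.Fin.Subset.∈ W))
    Q x y = (x <? y) ×-dec (y ∈? W)

∑-∈≡∣∣ : ∀ {n} (W : Subset n) → ∑[ y < n ] ⟦ does (y ∈? W) ⟧ ≡ ∣ W ∣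
∑-∈≡∣∣ [] = refl
∑-∈≡∣∣ (true ∷ W) = cong suc (∑-∈≡∣∣ W)
∑-∈≡∣∣ (false ∷ W) = ∑-∈≡∣∣ W

-- Pascal's rule: adding a new least element of W adds one pair per old element.
ascendingPairs≡C2 : ∀ {n} (W : Subset n) → ascendingPairs W ≡ ∣ W ∣ C 2
ascendingPairs≡C2 [] = refl
ascendingPairs≡C2 (true ∷ W) = begin
    1 * ∑[ y < _ ] ⟦ does (y ∈? W) ⟧ + ascendingPairs W
  ≡⟨ cong₂ _+_ (trans (*-identityˡ _) (trans (∑-∈≡∣∣ W) (sym (nC1≡n ∣ W ∣)))) (ascendingPairs≡C2 W) ⟩
    ∣ W ∣ C 1 + ∣ W ∣ C 2
  ≡⟨ nCk+nC[k+1]≡[n+1]C[k+1] ∣ W ∣ 1 ⟩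
    suc ∣ W ∣ C 2 ∎
  where open ≡-Reasoning
ascendingPairs≡C2 (false ∷ W) = ascendingPairs≡C2 W

length≤sum-of-positives : ∀ {a} {A : Set a} (f : A → ℤ.ℤ) xs → All (λ x → + 1 ≤ f x) xs →
  + length xs ≤ foldr ℤ._+_ (+ 0) (map f xs)
length≤sum-of-positives f [] [] = ℤ.+≤+ ℕ.z≤n
length≤sum-of-positives f (x ∷ xs) (1≤fx ∷ 1≤fxs) = ℤ.+-mono-≤ 1≤fx (length≤sum-of-positives f xs 1≤fxs)

lemma4 : (n : ℕ) (T : Digraph n) → IsTournament T → IsRegular T →
         (W : Subset n) → (+ (∣ W ∣ C 2)) ≤ surplusSet T W
lemma4 n T tournament regular W =
  subst (λ k → + k ≤ surplusSet T W) (trans (length-unorderedPairsIn W) (ascendingPairs≡C2 W))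
    (length≤sum-of-positives _ (unorderedPairsIn W)
      (All.map (surplus-positive T ∘ regular⇒2*π₂<p₂+p₂ tournament regular) (unorderedPairsIn-distinct W)))
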